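{- Let $s'(n)$ denote the maximum number of stable models of a normal logic program of size at most $n$. Then for every integer $n\ge1$, $s'(n)=\Theta(2^{n/4})$.
   Context: A (normal, propositional) logic program is a finite set of clauses $a\leftarrow b_1,\ldots,b_m,\mathbf{not}(c_1),\ldots,\mathbf{not}(c_k)$ ($m,k\ge0$) with atoms $a,b_i,c_j$. For a set of atoms $M$, the Gelfond–Lifschitz reduct $P^M$ is obtained from $P$ by deleting every clause whose body contains $\mathbf{not}(c)$ with $c\in M$ and deleting all negative literals from the remaining clauses; $M$ is a stable model of $P$ if $M$ is the least model of the Horn program $P^M$. The size of a program is the total number of atom occurrences in it (in heads and bodies, counting negated occurrences). -}

module Defs where

open import Data.Nat using (ℕ; suc; _+_; _≤_)
open import Data.Bool using (Bool; true; false; not)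
open import Data.List using (List; []; _∷_; length; map; filter)
open import Data.Nat.ListAction using (sum)
open import Data.Bool.ListAction using (all)
open import Data.List.Relation.Unary.All using (All)
open import Data.List.Relation.Unary.AllPairs using (AllPairs)
open import Data.List.Membership.Propositional using (_∈_)
open import Data.Product using (Σ; ∃; ∃-syntax; _×_; _,_)
open import Relation.Binary.PropositionalEquality using (_≡_; _≢_)
open import Function using (_∘_)

Atom : Set
Atom = ℕ

record Clause : Set where
  constructor _←_∣_
  field
    head : Atom
    pos  : List Atom
    neg  : List Atom
open Clause public

Program : Set
Program = List Clause

-- Size: total number of atom occurrences (heads, positive and negated body atoms).
clauseSize : Clause → ℕ
clauseSize c = suc (length (pos c) + length (neg c))

size : Program → ℕ
size P = sum (map clauseSize P)

AtomSet : Set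
AtomSet = Atom → Bool

_∈ₛ_ : Atom → AtomSet → Set
a ∈ₛ M = M a ≡ true

_⊆ₛ_ : AtomSet → AtomSet → Set
X ⊆ₛ Y = ∀ a → a ∈ₛ X → a ∈ₛ Y

record HornClause : Set where
  constructor _⇐_
  field
    hhead : Atom
    hbody : List Atom
open HornClause public

HornProgram : Set
HornProgram = List HornClause

-- Gelfond–Lifschitz reduct P^M: delete clauses with not(c), c ∈ M;
-- drop negative literals from the remaining ones.
reduct : Program → AtomSet → HornProgram
reduct P M =
  map (λ c → head c ⇐ pos c)
      (filter (λ c → Data.Bool.T? (all (not ∘ M) (neg c))) P)
  where import Data.Bool

IsModel : HornProgram → AtomSet → Set
IsModel H X = ∀ r → r ∈ H → All (λ b → b ∈ₛ X) (hbody r) → hhead r ∈ₛ X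

IsLeastModel : HornProgram → AtomSet → Set
IsLeastModel H X = IsModel H X × (∀ Y → IsModel H Y → X ⊆ₛ Y)

IsStable : Program → AtomSet → Set
IsStable P M = IsLeastModel (reduct P M) M

Differ : AtomSet → AtomSet → Set
Differ X Y = ∃[ a ] X a ≢ Y a

DistinctStableModels : Program → List AtomSet → Set
DistinctStableModels P Ms = All (IsStable P) Ms × AllPairs Differ Ms

IsMaxStableCount : ℕ → ℕ → Set
IsMaxStableCount n k =
  (∃[ P ] size P ≤ n × ∃[ Ms ] DistinctStableModels P Ms × length Ms ≡ k)
  × (∀ P → size P ≤ n → ∀ Ms → DistinctStableModels P Ms → length Ms ≤ k)

module Submission where

-- Let the weight of a program be its size, not counting facts.  By induction on the
-- weight w, a program has at most 2^⌊w/4⌋ distinct stable models.  A program without negation has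
-- at most one.  Otherwise "not c" occurs in some clause q.  The stable models making c true are
-- stable models of the program obtained by deleting the clauses containing "not c" or with head c
-- and adding the fact c; those making c false are stable models of the program obtained by deleting
-- the clauses with head c and every literal "not c".  Both are lighter (q is deleted, resp.
-- shortened).  If both kinds of models occur, a clause r justifying c in a model M₁ with c true is
-- no fact, since c is false in a model M₀; then the first program is at least 4 lighter (q and r are
-- deleted), and so is a program for the second kind: if r weighs 3 or more, the same one; if r is
-- "c ← e", all of them make e false and the clauses with head e can be deleted as well, among them
-- one justifying e in M₁, which is no fact as e is false in M₀; symmetrically if r is "c ← not d",
-- the clauses with head d are replaced by the fact d.  Finally 2·2^⌊(w-4)/4⌋ ≤ 2^⌊w/4⌋.
--
-- Lower bound.  ⌊n/4⌋ disjoint copies of {a ← not b, b ← not a} have size at most n and 2^⌊n/4⌋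
-- stable models.

open import Defs
open import Data.Nat using (ℕ; zero; suc; _+_; _*_; _^_; _≤_; _<_; z≤n; s≤s; _≟_)
open import Data.Product using (∃-syntax; _×_; _,_; proj₁; proj₂)
open import Data.Bool as Bool using (Bool; true; false; not; _∧_; T)
open import Data.Bool.ListAction using (all)
open import Data.Bool.Properties using (T-not-≡; ¬-not; not-¬; ⇔→≡)
open import Data.List using (List; []; _∷_; _++_; length; map; filter)
open import Data.List.Membership.DecPropositional _≟_ using (_∉?_)
open import Data.List.Membership.Propositional using (_∈_; _∉_; find; lose)
open import Data.List.Membership.Propositional.Properties using (∈-filter⁺; ∈-filter⁻; ∈-map⁺; ∈-map⁻)
open import Data.List.Properties
  using (map-∘; map-cong; length-map; length-++; length-filter; filter-all; filter-reject; filter-notAll)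
open import Data.List.Relation.Unary.All as All using (All; []; _∷_)
import Data.List.Relation.Unary.All.Properties as All
open import Data.List.Relation.Unary.AllPairs as AllPairs using (AllPairs; []; _∷_)
import Data.List.Relation.Unary.AllPairs.Properties as AllPairs
open import Data.List.Relation.Unary.Any as Any using (Any; here; there; any?)
import Data.List.Relation.Unary.Any.Properties as Any
open import Data.Nat.DivMod using (_/_; _%_; m≡m%n+[m/n]*n; m%n<n; m/n*n≤m; /-monoˡ-≤; +-distrib-/-∣ˡ)
open import Data.Nat.Divisibility using (∣-refl)
open import Data.Nat.Induction using (<-wellFounded)
open import Data.Nat.ListAction using (sum)
open import Data.Nat.Properties
  using (≤-refl; ≤-reflexive; ≤-trans; ≤-<-trans; <⇒≤; ≤-pred; n≤1+n; m≤n+m; m≤n⇒m≤o+n;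
         +-identityʳ; +-suc; +-cancelˡ-≡; +-mono-≤; +-monoˡ-≤; +-monoʳ-≤; +-monoʳ-<;
         +-mono-<-≤; +-mono-≤-<;
         *-identityˡ; *-monoˡ-≤; ^-monoʳ-≤; ^-distribˡ-+-*; ^-*-assoc; m^n>0; +-commutativeSemigroup;
         module ≤-Reasoning)
open import Algebra.Properties.CommutativeSemigroup +-commutativeSemigroup using (x∙yz≈y∙xz)
open import Data.Sum using (_⊎_; inj₁; inj₂)
open import Function using (_∘_; _on_; _⇔_; mk⇔; Equivalence)
open import Induction.WellFounded using (Acc; acc)
open import Relation.Binary.Construct.On using (wellFounded)
open import Relation.Binary.PropositionalEquality using (_≡_; _≢_; refl; sym; trans; cong; cong₂; subst)
open import Relation.Nullary using (¬_; Dec; yes; no; does; contradiction; _×-dec_; ¬?)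
open import Relation.Nullary.Decidable using (decidable-stable)
open import Relation.Unary using (Decidable)
open import Relation.Unary.Properties using (∁?)

module _ {A : Set} (f : A → ℕ) where

  sum-map-filter≤ : ∀ {Q : A → Set} (Q? : Decidable Q) xs → sum (map f (filter Q? xs)) ≤ sum (map f xs)
  sum-map-filter≤ Q? [] = z≤n
  sum-map-filter≤ Q? (x ∷ xs) with does (Q? x)
  ... | true  = +-monoʳ-≤ (f x) (sum-map-filter≤ Q? xs)
  ... | false = m≤n⇒m≤o+n (f x) (sum-map-filter≤ Q? xs)

  sum-map-filter-reject : ∀ {Q : A → Set} (Q? : Decidable Q) {x xs} → x ∈ xs → ¬ Q x →
                          f x + sum (map f (filter Q? xs)) ≤ sum (map f xs)
  sum-map-filter-reject Q? {xs = x ∷ xs} (here refl) ¬Qx rewrite filter-reject Q? {xs = xs} ¬Qx =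
    +-monoʳ-≤ (f x) (sum-map-filter≤ Q? xs)
  sum-map-filter-reject Q? {x} {y ∷ xs} (there x∈) ¬Qx with does (Q? y)
  ... | true  = ≤-trans (≤-reflexive (x∙yz≈y∙xz (f x) (f y) _))
                        (+-monoʳ-≤ (f y) (sum-map-filter-reject Q? x∈ ¬Qx))
  ... | false = m≤n⇒m≤o+n (f y) (sum-map-filter-reject Q? x∈ ¬Qx)

  sum-map-mono : ∀ {g : A → ℕ} → (∀ x → g x ≤ f x) → ∀ xs → sum (map g xs) ≤ sum (map f xs)
  sum-map-mono g≤f [] = z≤n
  sum-map-mono g≤f (x ∷ xs) = +-mono-≤ (g≤f x) (sum-map-mono g≤f xs)

  sum-map-mono-< : ∀ {g : A → ℕ} → (∀ x → g x ≤ f x) → ∀ {x xs} → x ∈ xs → g x < f x →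
                   sum (map g xs) < sum (map f xs)
  sum-map-mono-< g≤f {xs = _ ∷ xs} (here refl) gx<fx = +-mono-<-≤ gx<fx (sum-map-mono g≤f xs)
  sum-map-mono-< g≤f {xs = y ∷ _} (there x∈) gx<fx = +-mono-≤-< (g≤f y) (sum-map-mono-< g≤f x∈ gx<fx)

length-filter-∁ : ∀ {A : Set} {Q : A → Set} (Q? : Decidable Q) xs →
                  length (filter Q? xs) + length (filter (∁? Q?) xs) ≡ length xs
length-filter-∁ Q? [] = refl
length-filter-∁ Q? (x ∷ xs) with does (Q? x)
... | true  = cong suc (length-filter-∁ Q? xs)
... | false = trans (+-suc _ _) (cong suc (length-filter-∁ Q? xs))

2^-merge : ∀ {a b k} → a < k → b < k → 2 ^ a + 2 ^ b ≤ 2 ^ k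
2^-merge {k = suc k} (s≤s a≤k) (s≤s b≤k) = ≤-trans
  (+-mono-≤ (^-monoʳ-≤ 2 a≤k) (^-monoʳ-≤ 2 b≤k))
  (≤-reflexive (cong (2 ^ k +_) (sym (+-identityʳ (2 ^ k)))))

2^⌊/4⌋-mono : ∀ {m n} → m ≤ n → 2 ^ (m / 4) ≤ 2 ^ (n / 4)
2^⌊/4⌋-mono m≤n = ^-monoʳ-≤ 2 (/-monoˡ-≤ 4 m≤n)

2^⌊/4⌋-merge : ∀ {m m′ n} → 4 + m ≤ n → 4 + m′ ≤ n → 2 ^ (m / 4) + 2 ^ (m′ / 4) ≤ 2 ^ (n / 4)
2^⌊/4⌋-merge {m} {m′} {n} le le′ = 2^-merge (⌊/4⌋< m le) (⌊/4⌋< m′ le′)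
  where
  ⌊/4⌋< : ∀ k → 4 + k ≤ n → k / 4 < n / 4
  ⌊/4⌋< k le = subst (_≤ n / 4) (+-distrib-/-∣ˡ k {4} ∣-refl) (/-monoˡ-≤ 4 le)

2^n≤8*[2^⌊n/4⌋]^4 : ∀ n → 2 ^ n ≤ 8 * (2 ^ (n / 4)) ^ 4
2^n≤8*[2^⌊n/4⌋]^4 n = begin
  2 ^ n                            ≡⟨ cong (2 ^_) (m≡m%n+[m/n]*n n 4) ⟩
  2 ^ (n % 4 + n / 4 * 4)          ≡⟨ ^-distribˡ-+-* 2 (n % 4) (n / 4 * 4) ⟩
  2 ^ (n % 4) * 2 ^ (n / 4 * 4)    ≤⟨ *-monoˡ-≤ (2 ^ (n / 4 * 4)) (^-monoʳ-≤ 2 (≤-pred (m%n<n n 4))) ⟩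
  8 * 2 ^ (n / 4 * 4)              ≡⟨ cong (8 *_) (^-*-assoc 2 (n / 4) 4) ⟨
  8 * (2 ^ (n / 4)) ^ 4            ∎
  where open ≤-Reasoning

[2^⌊n/4⌋]^4≤2^n : ∀ n → (2 ^ (n / 4)) ^ 4 ≤ 1 * 2 ^ n
[2^⌊n/4⌋]^4≤2^n n = begin
  (2 ^ (n / 4)) ^ 4   ≡⟨ ^-*-assoc 2 (n / 4) 4 ⟩
  2 ^ (n / 4 * 4)     ≤⟨ ^-monoʳ-≤ 2 (m/n*n≤m n 4) ⟩
  2 ^ n               ≡⟨ *-identityˡ (2 ^ n) ⟨
  1 * 2 ^ n           ∎
  where open ≤-Reasoning

-- Stable models

Active : AtomSet → Clause → Set
Active M x = All (λ c → M c ≡ false) (neg x)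

ReductModel : Program → AtomSet → AtomSet → Set
ReductModel P M Y = ∀ {x} → x ∈ P → Active M x → All (_∈ₛ Y) (pos x) → head x ∈ₛ Y

Stable : Program → AtomSet → Set
Stable P M = ReductModel P M M × (∀ Y → ReductModel P M Y → M ⊆ₛ Y)

active⇔T : ∀ M x → Active M x ⇔ T (all (not ∘ M) (neg x))
active⇔T M x = mk⇔ (All.all⁻ _ ∘ All.map (Equivalence.from T-not-≡))
                    (All.map (Equivalence.to T-not-≡) ∘ All.all⁺ _ (neg x))

reductModel⇔isModel : ∀ P M Y → ReductModel P M Y ⇔ IsModel (reduct P M) Y
reductModel⇔isModel P M Y = mk⇔ to from
  where
  active? : Decidable (λ x → T (all (not ∘ M) (neg x)))
  active? x = Bool.T? (all (not ∘ M) (neg x))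
  to : ReductModel P M Y → IsModel (reduct P M) Y
  to model r r∈ body with ∈-map⁻ (λ x → head x ⇐ pos x) r∈
  ... | x , x∈ , refl = let x∈P , act = ∈-filter⁻ active? {xs = P} x∈ in
                        model x∈P (Equivalence.from (active⇔T M x) act) body
  from : IsModel (reduct P M) Y → ReductModel P M Y
  from model {x} x∈P act = model (head x ⇐ pos x)
    (∈-map⁺ _ (∈-filter⁺ active? x∈P (Equivalence.to (active⇔T M x) act)))

isStable⇔stable : ∀ {P M} → IsStable P M ⇔ Stable P M
isStable⇔stable {P} {M} = mk⇔
  (λ (model , least) → from (model⇔ M) model , λ Y → least Y ∘ to (model⇔ Y))
  (λ (model , least) → to (model⇔ M) model , λ Y → least Y ∘ from (model⇔ Y))
  where
  open Equivalence using (to; from)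
  model⇔ : ∀ Y → ReductModel P M Y ⇔ IsModel (reduct P M) Y
  model⇔ = reductModel⇔isModel P M

_∩_ : AtomSet → AtomSet → AtomSet
(X ∩ Y) a = X a ∧ Y a

∈-∩⁺ : ∀ X Y {a} → a ∈ₛ X → a ∈ₛ Y → a ∈ₛ (X ∩ Y)
∈-∩⁺ X Y a∈X a∈Y rewrite a∈X = a∈Y

∈-∩⁻ : ∀ X Y {a} → a ∈ₛ (X ∩ Y) → a ∈ₛ X × a ∈ₛ Y
∈-∩⁻ X Y {a} a∈X∩Y with X a | Y a | a∈X∩Y
... | true  | true  | _  = refl , refl
... | true  | false | ()
... | false | _     | ()

_∖_ : AtomSet → Atom → AtomSet
(M ∖ a) b with b ≟ a
... | yes _ = false
... | no _  = M b

∈-∖⁺ : ∀ M a {b} → b ∈ₛ M → b ≢ a → b ∈ₛ (M ∖ a)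
∈-∖⁺ M a {b} b∈M b≢a with b ≟ a
... | yes b≡a = contradiction b≡a b≢a
... | no _    = b∈M

∈-∖⁻ : ∀ M a {b} → b ∈ₛ (M ∖ a) → b ∈ₛ M × b ≢ a
∈-∖⁻ M a {b} b∈M∖a with b ≟ a
... | no b≢a = b∈M∖a , b≢a

reductModel-∩ : ∀ {P M X Y} → ReductModel P M X → ReductModel P M Y → ReductModel P M (X ∩ Y)
reductModel-∩ {X = X} {Y} modelX modelY x∈P act body = ∈-∩⁺ X Y
  (modelX x∈P act (All.map (proj₁ ∘ ∈-∩⁻ X Y) body))
  (modelY x∈P act (All.map (proj₂ ∘ ∈-∩⁻ X Y) body))

-- Minimality need only be tested against models Y ⊆ M, since Y ∩ M is a model whenever Y is.
stable-transfer : ∀ {P P′ M} → Stable P M → ReductModel P′ M M →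
                  (∀ {Y} → ReductModel P′ M Y → Y ⊆ₛ M → ReductModel P M Y) → Stable P′ M
stable-transfer {M = M} (_ , least) model′ reflect = model′ , λ Y modelY a a∈M →
  proj₁ (∈-∩⁻ Y M (least (Y ∩ M) (reflect (reductModel-∩ modelY model′) (λ _ → proj₂ ∘ ∈-∩⁻ Y M))
                         a a∈M))

Justifies : AtomSet → Atom → Clause → Set
Justifies M a x = head x ≡ a × Active M x × All (λ b → b ∈ₛ M × b ≢ a) (pos x)

justifies? : ∀ M a x → Dec (Justifies M a x)
justifies? M a x = head x ≟ a
  ×-dec All.all? (λ c → M c Bool.≟ false) (neg x)
  ×-dec All.all? (λ b → (M b Bool.≟ true) ×-dec ¬? (b ≟ a)) (pos x)

-- Otherwise M ∖ a would be a smaller model of the reduct.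
stable⇒justified : ∀ {P M a} → Stable P M → a ∈ₛ M → Any (Justifies M a) P
stable⇒justified {P} {M} {a} (model , least) a∈M with any? (justifies? M a) P
... | yes justified = justified
... | no unjustified = contradiction refl (proj₂ (∈-∖⁻ M a (least (M ∖ a) model∖a a a∈M)))
  where
  model∖a : ReductModel P M (M ∖ a)
  model∖a x∈P act body = ∈-∖⁺ M a (model x∈P act (All.map (proj₁ ∘ ∈-∖⁻ M a) body))
    λ head≡a → unjustified (lose x∈P (head≡a , act , All.map (∈-∖⁻ M a) body))

Supported : Program → AtomSet → Set
Supported P M = ReductModel P M M × (∀ a → a ∈ₛ M → Any (Justifies M a) P)

Negative : Program → Set
Negative P = All (λ x → pos x ≡ []) P

supported⇒stable : ∀ {P M} → Negative P → Supported P M → Stable P M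
supported⇒stable negative (model , supported) = model , λ Y modelY a a∈M →
  let x , x∈P , head≡a , act , _ = find (supported a a∈M)
  in subst (_∈ₛ Y) head≡a (modelY x∈P act (subst (All (_∈ₛ Y)) (sym (All.lookup negative x∈P)) []))

Horn : Program → Set
Horn P = All (λ x → neg x ≡ []) P

horn⊎negation : ∀ P → Horn P ⊎ ∃[ q ] ∃[ c ] q ∈ P × c ∈ neg q
horn⊎negation [] = inj₁ []
horn⊎negation ((_ ← _ ∣ []) ∷ P) with horn⊎negation P
... | inj₁ horn = inj₁ (refl ∷ horn)
... | inj₂ (q , c , q∈P , c∈q) = inj₂ (q , c , there q∈P , c∈q)
horn⊎negation ((_ ← _ ∣ (c ∷ _)) ∷ _) = inj₂ (_ , c , here refl , here refl)

horn-stable-⊆ : ∀ {P M M′} → Horn P → Stable P M → Stable P M′ → M ⊆ₛ M′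
horn-stable-⊆ {M′ = M′} horn (_ , least) (model′ , _) = least M′ λ x∈P _ →
  model′ x∈P (subst (All _) (sym (All.lookup horn x∈P)) [])

horn-atMostOne : ∀ {P Ms} → Horn P → All (Stable P) Ms → AllPairs Differ Ms → length Ms ≤ 1
horn-atMostOne horn [] [] = z≤n
horn-atMostOne horn (_ ∷ []) _ = s≤s z≤n
horn-atMostOne horn (s ∷ s′ ∷ _) (((a , M≢M′) ∷ _) ∷ _) =
  contradiction (⇔→≡ (mk⇔ (horn-stable-⊆ horn s s′ a) (horn-stable-⊆ horn s′ s a))) M≢M′

-- Program transformations

fact : Atom → Clause
fact a = a ← [] ∣ []

dropHead : Atom → Program → Program
dropHead c = filter (λ x → ¬? (head x ≟ c))

dropNeg : Atom → Program → Program
dropNeg c = filter (λ x → c ∉? neg x)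

setTrue : Atom → Program → Program
setTrue c P = fact c ∷ dropHead c P

stripClause : Atom → Clause → Clause
stripClause c x = head x ← pos x ∣ filter (λ b → ¬? (b ≟ c)) (neg x)

strip : Atom → Program → Program
strip c = map (stripClause c)

active⇒∉neg : ∀ {M c} x → Active M x → c ∈ₛ M → c ∉ neg x
active⇒∉neg x act c∈M c∈x = not-¬ c∈M (All.lookup act c∈x)

All-filter-≢⁻ : ∀ {Q : Atom → Set} {c} xs → Q c → All Q (filter (λ b → ¬? (b ≟ c)) xs) → All Q xs
All-filter-≢⁻ {Q} {c} xs Qc Qxs′ = All.filter⁻ _ Qxs′ (All.tabulate λ b∈ →
  subst Q (sym (decidable-stable (_ ≟ c) (proj₂ (∈-filter⁻ (¬? ∘ λ b → ¬? (b ≟ c)) {xs = xs} b∈))))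
        Qc)

module _ {P : Program} {M : AtomSet} {c : Atom} where

  stable-dropNeg : c ∈ₛ M → Stable P M → Stable (dropNeg c P) M
  stable-dropNeg c∈M s@(model , _) = stable-transfer s
    (λ x∈ → model (proj₁ (∈-filter⁻ _ x∈)))
    (λ model′ _ {x} x∈P act → model′ (∈-filter⁺ _ x∈P (active⇒∉neg x act c∈M)) act)

  stable-dropHead : M c ≡ false → Stable P M → Stable (dropHead c P) M
  stable-dropHead c∉M s@(model , _) = stable-transfer s
    (λ x∈ → model (proj₁ (∈-filter⁻ _ x∈)))
    (λ model′ Y⊆M x∈P act body → model′ (∈-filter⁺ _ x∈P λ head≡c →
      not-¬ (model x∈P act (All.map (Y⊆M _) body)) (trans (cong M head≡c) c∉M)) act body)

  stable-setTrue : c ∈ₛ M → Stable P M → Stable (setTrue c P) M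
  stable-setTrue c∈M s@(model , _) = stable-transfer s model′ reflect
    where
    model′ : ReductModel (setTrue c P) M M
    model′ (here refl) _ _ = c∈M
    model′ (there x∈) act body = model (proj₁ (∈-filter⁻ _ x∈)) act body
    reflect : ∀ {Y} → ReductModel (setTrue c P) M Y → Y ⊆ₛ M → ReductModel P M Y
    reflect modelY _ {x} x∈P act body with head x ≟ c
    ... | yes refl = modelY (here refl) [] []
    ... | no head≢c = modelY (there (∈-filter⁺ _ x∈P head≢c)) act body

  stable-strip : M c ≡ false → Stable P M → Stable (strip c P) M
  stable-strip c∉M s@(model , _) = stable-transfer s model′
    (λ modelY _ x∈P act → modelY (∈-map⁺ _ x∈P) (All.filter⁺ _ act))
    where
    model′ : ReductModel (strip c P) M M
    model′ x′∈ act′ body with ∈-map⁻ _ x′∈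
    ... | x , x∈P , refl = model x∈P (All-filter-≢⁻ (neg x) c∉M act′) body

-- Facts weigh nothing, so that replacing the clauses for an atom by a fact never adds weight.
weight : Clause → ℕ
weight (_ ← [] ∣ []) = 0
weight x = clauseSize x

totalWeight : Program → ℕ
totalWeight P = sum (map weight P)

weight≤clauseSize : ∀ x → weight x ≤ clauseSize x
weight≤clauseSize (_ ← [] ∣ []) = z≤n
weight≤clauseSize (_ ← [] ∣ (_ ∷ _)) = ≤-refl
weight≤clauseSize (_ ← (_ ∷ _) ∣ _) = ≤-refl

weight-monoʳ-≤ : ∀ a ps {ns′ ns : List Atom} → length ns′ ≤ length ns →
                 weight (a ← ps ∣ ns′) ≤ weight (a ← ps ∣ ns)
weight-monoʳ-≤ a []       {[]}            _  = z≤n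
weight-monoʳ-≤ a []       {_ ∷ _} {_ ∷ _} le = s≤s le
weight-monoʳ-≤ a (_ ∷ ps) le = s≤s (s≤s (+-monoʳ-≤ (length ps) le))

weight-monoʳ-< : ∀ a ps {ns′ ns : List Atom} → length ns′ < length ns →
                 weight (a ← ps ∣ ns′) < weight (a ← ps ∣ ns)
weight-monoʳ-< a []       {[]}    {_ ∷ _} _  = s≤s z≤n
weight-monoʳ-< a []       {_ ∷ _} {_ ∷ _} lt = s≤s lt
weight-monoʳ-< a (_ ∷ ps) lt = s≤s (s≤s (+-monoʳ-< (length ps) lt))

weight-strip≤ : ∀ c x → weight (stripClause c x) ≤ weight x
weight-strip≤ c x = weight-monoʳ-≤ (head x) (pos x) (length-filter _ (neg x))

weight-strip< : ∀ {c x} → c ∈ neg x → weight (stripClause c x) < weight x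
weight-strip< {c} {x} c∈x = weight-monoʳ-< (head x) (pos x)
  (filter-notAll _ (neg x) (Any.map (λ c≡b b≢c → b≢c (sym c≡b)) c∈x))

stripClause-∉ : ∀ {c x} → c ∉ neg x → stripClause c x ≡ x
stripClause-∉ {c} {x} c∉x = cong (head x ← pos x ∣_)
  (filter-all _ (All.tabulate λ b∈x b≡c → c∉x (subst (_∈ neg x) b≡c b∈x)))

2≤weight-neg : ∀ {c} x → c ∈ neg x → 2 ≤ weight x
2≤weight-neg (_ ← [] ∣ (_ ∷ _)) _ = s≤s (s≤s z≤n)
2≤weight-neg (_ ← (_ ∷ _) ∣ _)  _ = s≤s (s≤s z≤n)

data Light : Clause → Set where
  is-fact : ∀ a → Light (a ← [] ∣ [])
  one-pos : ∀ a e → Light (a ← (e ∷ []) ∣ [])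
  one-neg : ∀ a d → Light (a ← [] ∣ (d ∷ []))

light⊎heavy : ∀ x → Light x ⊎ 3 ≤ weight x
light⊎heavy (a ← [] ∣ []) = inj₁ (is-fact a)
light⊎heavy (a ← (e ∷ []) ∣ []) = inj₁ (one-pos a e)
light⊎heavy (a ← [] ∣ (d ∷ [])) = inj₁ (one-neg a d)
light⊎heavy (_ ← [] ∣ (_ ∷ _ ∷ _)) = inj₂ (s≤s (s≤s (s≤s z≤n)))
light⊎heavy (_ ← (_ ∷ []) ∣ (_ ∷ _)) = inj₂ (s≤s (s≤s (s≤s z≤n)))
light⊎heavy (_ ← (_ ∷ _ ∷ _) ∣ _) = inj₂ (s≤s (s≤s (s≤s z≤n)))

model⇒2≤weight : ∀ {P M x} → ReductModel P M M → x ∈ P → M (head x) ≡ false → 2 ≤ weight x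
model⇒2≤weight {x = x} model x∈P head∉M with light⊎heavy x
... | inj₁ (is-fact _)  = contradiction (model x∈P [] []) (λ head∈M → not-¬ head∈M head∉M)
... | inj₁ (one-pos _ _) = ≤-refl
... | inj₁ (one-neg _ _) = ≤-refl
... | inj₂ heavy        = ≤-trans (n≤1+n 2) heavy

totalWeight-strip≤ : ∀ c P → totalWeight (strip c P) ≤ totalWeight P
totalWeight-strip≤ c P =
  subst (_≤ totalWeight P) (cong sum (map-∘ P)) (sum-map-mono weight (weight-strip≤ c) P)

totalWeight-strip< : ∀ {c P q} → q ∈ P → c ∈ neg q → totalWeight (strip c P) < totalWeight P
totalWeight-strip< {c} {P} q∈P c∈q = subst (_< totalWeight P) (cong sum (map-∘ P))
  (sum-map-mono-< weight (weight-strip≤ c) q∈P (weight-strip< c∈q))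

totalWeight-dropHead² : ∀ {P r x c a} → r ∈ P → head r ≡ c → x ∈ P → head x ≡ a → a ≢ c →
                        2 ≤ weight r → 2 ≤ weight x →
                        4 + totalWeight (dropHead a (dropHead c P)) ≤ totalWeight P
totalWeight-dropHead² {P} {r} {x} {c} {a} r∈P head≡c x∈P head≡a a≢c 2≤r 2≤x = ≤-trans
  (+-mono-≤ 2≤r (+-monoˡ-≤ _ 2≤x))
  (≤-trans (+-monoʳ-≤ (weight r) (sum-map-filter-reject weight _ x∈dropHead (λ x≢a → x≢a head≡a)))
           (sum-map-filter-reject weight _ r∈P (λ r≢c → r≢c head≡c)))
  where
  x∈dropHead : x ∈ dropHead c P
  x∈dropHead = ∈-filter⁺ _ x∈P (λ x≡c → a≢c (trans (sym head≡a) x≡c))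

totalWeight≤size : ∀ P → totalWeight P ≤ size P
totalWeight≤size = sum-map-mono clauseSize weight≤clauseSize

-- Upper bound

assumeTrue : Atom → Program → Program
assumeTrue c P = setTrue c (dropNeg c P)

assumeFalse : Atom → Program → Program
assumeFalse c P = dropHead c (strip c P)

stable-assumeTrue : ∀ {P M c} → Stable P M × c ∈ₛ M → Stable (assumeTrue c P) M
stable-assumeTrue (s , c∈M) = stable-setTrue c∈M (stable-dropNeg c∈M s)

stable-assumeFalse : ∀ {P M c} → Stable P M × M c ≡ false → Stable (assumeFalse c P) M
stable-assumeFalse (s , c∉M) = stable-dropHead c∉M (stable-strip c∉M s)

module _ {P q c} (q∈P : q ∈ P) (c∈q : c ∈ neg q) where

  totalWeight-assumeTrue< : totalWeight (assumeTrue c P) < totalWeight P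
  totalWeight-assumeTrue< = ≤-trans
    (+-mono-≤ (≤-trans (n≤1+n 1) (2≤weight-neg q c∈q)) (sum-map-filter≤ weight _ (dropNeg c P)))
    (sum-map-filter-reject weight _ q∈P (λ c∉q → c∉q c∈q))

  totalWeight-assumeTrue+4 : ∀ {r} → r ∈ P → head r ≡ c → c ∉ neg r → 2 ≤ weight r →
                             4 + totalWeight (assumeTrue c P) ≤ totalWeight P
  totalWeight-assumeTrue+4 r∈P head≡c c∉r 2≤r = ≤-trans
    (+-mono-≤ (2≤weight-neg q c∈q) (+-monoˡ-≤ _ 2≤r))
    (≤-trans (+-monoʳ-≤ (weight q)
               (sum-map-filter-reject weight _ (∈-filter⁺ _ r∈P c∉r) λ r≢c → r≢c head≡c))
             (sum-map-filter-reject weight _ q∈P (λ c∉q → c∉q c∈q)))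

  totalWeight-assumeFalse< : totalWeight (assumeFalse c P) < totalWeight P
  totalWeight-assumeFalse< = ≤-<-trans (sum-map-filter≤ weight _ (strip c P)) (totalWeight-strip< q∈P c∈q)

FalseBranch : Program → Atom → Set
FalseBranch P c =
  ∃[ P′ ] 4 + totalWeight P′ ≤ totalWeight P × (∀ {M} → Stable P M × M c ≡ false → Stable P′ M)

module _ {P c M₁ M₀} (s₁ : Stable P M₁) (c∈M₁ : c ∈ₛ M₁) (s₀ : Stable P M₀) (c∉M₀ : M₀ c ≡ false)
  where

  falseBranch-heavy : ∀ {q r} → q ∈ P → c ∈ neg q → r ∈ P → head r ≡ c → Active M₁ r →
                      3 ≤ weight r → FalseBranch P c
  falseBranch-heavy {r = r} q∈P c∈q r∈P head≡c act₁ heavy = assumeFalse c P , shrinks , stable-assumeFalse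
    where
    3≤r′ : 3 ≤ weight (stripClause c r)
    3≤r′ = subst (λ r′ → 3 ≤ weight r′) (sym (stripClause-∉ (active⇒∉neg r act₁ c∈M₁))) heavy
    shrinks : 4 + totalWeight (assumeFalse c P) ≤ totalWeight P
    shrinks = ≤-trans
      (s≤s (≤-trans (+-monoˡ-≤ _ 3≤r′)
                    (sum-map-filter-reject weight _ (∈-map⁺ _ r∈P) λ r≢c → r≢c head≡c)))
      (totalWeight-strip< q∈P c∈q)

  falseBranch-pos : ∀ {e} → (c ← (e ∷ []) ∣ []) ∈ P → e ∈ₛ M₁ → e ≢ c → FalseBranch P c
  falseBranch-pos {e} r∈P e∈M₁ e≢c =
    strip c (dropHead e (dropHead c P)) , shrinks ,
    λ h@(s , c∉M) → stable-strip c∉M (stable-dropHead (e∉ h) (stable-dropHead c∉M s))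
    where
    e∉ : ∀ {M} → Stable P M × M c ≡ false → M e ≡ false
    e∉ ((model , _) , c∉M) = ¬-not λ e∈M → not-¬ (model r∈P [] (e∈M ∷ [])) c∉M
    shrinks : 4 + totalWeight (strip c (dropHead e (dropHead c P))) ≤ totalWeight P
    shrinks with x , x∈P , head≡e , _ ← find (stable⇒justified s₁ e∈M₁) = ≤-trans
      (+-monoʳ-≤ 4 (totalWeight-strip≤ c (dropHead e (dropHead c P))))
      (totalWeight-dropHead² r∈P refl x∈P head≡e e≢c ≤-refl
        (model⇒2≤weight (proj₁ s₀) x∈P (trans (cong M₀ head≡e) (e∉ (s₀ , c∉M₀)))))

  -- "not c" is stripped last, as the clause justifying d, whose whole weight is counted, may contain it.
  falseBranch-neg : ∀ {d} → (c ← [] ∣ (d ∷ [])) ∈ P → M₁ d ≡ false → FalseBranch P c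
  falseBranch-neg {d} r∈P d∉M₁ =
    strip c (setTrue d (dropHead c P)) , shrinks ,
    λ h@(s , c∉M) → stable-strip c∉M (stable-setTrue (d∈ h) (stable-dropHead c∉M s))
    where
    d∈ : ∀ {M} → Stable P M × M c ≡ false → d ∈ₛ M
    d∈ ((model , _) , c∉M) = ¬-not λ d∉M → not-¬ (model r∈P (d∉M ∷ []) []) c∉M
    d≢c : d ≢ c
    d≢c refl = not-¬ c∈M₁ d∉M₁
    shrinks : 4 + totalWeight (strip c (setTrue d (dropHead c P))) ≤ totalWeight P
    shrinks with x , x∈P , head≡d , _ ← find (stable⇒justified s₀ (d∈ (s₀ , c∉M₀))) = ≤-trans
      (+-monoʳ-≤ 4 (totalWeight-strip≤ c (setTrue d (dropHead c P))))
      (totalWeight-dropHead² r∈P refl x∈P head≡d d≢c ≤-refl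
        (model⇒2≤weight (proj₁ s₁) x∈P (trans (cong M₁ head≡d) d∉M₁)))

  falseBranch : ∀ {q r} → q ∈ P → c ∈ neg q → r ∈ P → Justifies M₁ c r → FalseBranch P c
  falseBranch {r = r} _ _ _ _ with light⊎heavy r
  falseBranch q∈P c∈q r∈P (refl , _ , _) | inj₁ (is-fact _) =
    contradiction (proj₁ s₀ r∈P [] []) (λ c∈M₀ → not-¬ c∈M₀ c∉M₀)
  falseBranch q∈P c∈q r∈P (refl , _ , (e∈M₁ , e≢c) ∷ []) | inj₁ (one-pos _ _) =
    falseBranch-pos r∈P e∈M₁ e≢c
  falseBranch q∈P c∈q r∈P (refl , d∉M₁ ∷ [] , _) | inj₁ (one-neg _ _) =
    falseBranch-neg r∈P d∉M₁
  falseBranch q∈P c∈q r∈P (head≡c , act₁ , _) | inj₂ heavy =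
    falseBranch-heavy q∈P c∈q r∈P head≡c act₁ heavy

CountBound : Program → Set
CountBound P = ∀ {Ms} → All (Stable P) Ms → AllPairs Differ Ms → length Ms ≤ 2 ^ (totalWeight P / 4)

module _ {P} (rec : ∀ {P′} → totalWeight P′ < totalWeight P → CountBound P′)
         {q c} (q∈P : q ∈ P) (c∈q : c ∈ neg q) where

  countBound-split : ∀ {Ms₁ Ms₀} → All (λ M → Stable P M × c ∈ₛ M) Ms₁ → AllPairs Differ Ms₁ →
                     All (λ M → Stable P M × M c ≡ false) Ms₀ → AllPairs Differ Ms₀ →
                     length Ms₁ + length Ms₀ ≤ 2 ^ (totalWeight P / 4)
  countBound-split {[]} _ _ h₀ d₀ = ≤-trans
    (rec (totalWeight-assumeFalse< q∈P c∈q) (All.map stable-assumeFalse h₀) d₀)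
    (2^⌊/4⌋-mono (<⇒≤ (totalWeight-assumeFalse< q∈P c∈q)))
  countBound-split {Ms₁@(_ ∷ _)} {[]} h₁ d₁ _ _ =
    subst (_≤ 2 ^ (totalWeight P / 4)) (sym (+-identityʳ (length Ms₁))) (≤-trans
      (rec (totalWeight-assumeTrue< q∈P c∈q) (All.map stable-assumeTrue h₁) d₁)
      (2^⌊/4⌋-mono (<⇒≤ (totalWeight-assumeTrue< q∈P c∈q))))
  countBound-split {_ ∷ _} {M₀ ∷ _} h₁@((s₁ , c∈M₁) ∷ _) d₁ h₀@((s₀ , c∉M₀) ∷ _) d₀
    with r , r∈P , j@(head≡c , act₁ , _) ← find (stable⇒justified s₁ c∈M₁)
    with P′ , shrinks , preserves ← falseBranch s₁ c∈M₁ s₀ c∉M₀ q∈P c∈q r∈P j = ≤-trans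
      (+-mono-≤ (rec (totalWeight-assumeTrue< q∈P c∈q) (All.map stable-assumeTrue h₁) d₁)
                (rec (≤-trans (s≤s (m≤n+m _ 3)) shrinks) (All.map preserves h₀) d₀))
      (2^⌊/4⌋-merge (totalWeight-assumeTrue+4 q∈P c∈q r∈P head≡c (active⇒∉neg r act₁ c∈M₁)
                      (model⇒2≤weight (proj₁ s₀) r∈P (trans (cong M₀ head≡c) c∉M₀)))
                    shrinks)

countBound-step : ∀ {P} → (∀ {P′} → totalWeight P′ < totalWeight P → CountBound P′) → CountBound P
countBound-step {P} rec {Ms} stable distinct with horn⊎negation P
... | inj₁ horn = ≤-trans (horn-atMostOne horn stable distinct) (m^n>0 2 (totalWeight P / 4))
... | inj₂ (q , c , q∈P , c∈q) = subst (_≤ 2 ^ (totalWeight P / 4)) (length-filter-∁ c∈? Ms)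
  (countBound-split rec q∈P c∈q
    (All.zip (All.filter⁺ c∈? stable , All.all-filter c∈? Ms)) (AllPairs.filter⁺ c∈? distinct)
    (All.zip (All.filter⁺ (∁? c∈?) stable , All.map ¬-not (All.all-filter (∁? c∈?) Ms)))
    (AllPairs.filter⁺ (∁? c∈?) distinct))
  where
  c∈? : Decidable (c ∈ₛ_)
  c∈? M = M c Bool.≟ true

countBound : ∀ P → CountBound P
countBound P = go P (wellFounded totalWeight <-wellFounded P)
  where
  go : ∀ P → Acc (_<_ on totalWeight) P → CountBound P
  go P (acc rs) = countBound-step (λ lt → go _ (rs lt))

-- Lower bound

rename : (Atom → Atom) → Clause → Clause
rename f x = f (head x) ← map f (pos x) ∣ map f (neg x)

size-map-rename : ∀ f P → size (map (rename f) P) ≡ size P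
size-map-rename f P = cong sum (trans (sym (map-∘ P)) (map-cong clauseSize-rename P))
  where
  clauseSize-rename : ∀ x → clauseSize (rename f x) ≡ clauseSize x
  clauseSize-rename x = cong₂ (λ m n → suc (m + n)) (length-map f (pos x)) (length-map f (neg x))

-- The i-th copy of {a ← not b, b ← not a} uses the atoms 2i and 2i+1.
pairs : ℕ → Program
pairs zero = []
pairs (suc m) = (0 ← [] ∣ (1 ∷ [])) ∷ (1 ← [] ∣ (0 ∷ [])) ∷ map (rename (2 +_)) (pairs m)

size-pairs : ∀ m → size (pairs m) ≡ m * 4
size-pairs zero = refl
size-pairs (suc m) = cong (4 +_) (trans (size-map-rename (2 +_) (pairs m)) (size-pairs m))

negative-pairs : ∀ m → Negative (pairs m)
negative-pairs zero = []
negative-pairs (suc m) = refl ∷ refl ∷ All.map⁺ (All.map (cong (map (2 +_))) (negative-pairs m))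

extend : Bool → AtomSet → AtomSet
extend b M 0 = b
extend b M 1 = not b
extend b M (suc (suc a)) = M a

pairModels : ℕ → List AtomSet
pairModels zero = (λ _ → false) ∷ []
pairModels (suc m) = map (extend true) (pairModels m) ++ map (extend false) (pairModels m)

length-pairModels : ∀ m → length (pairModels m) ≡ 2 ^ m
length-pairModels zero = refl
length-pairModels (suc m) = trans (length-++ (map (extend true) (pairModels m)))
  (cong₂ _+_ (trans (length-map _ (pairModels m)) (length-pairModels m))
             (trans (length-map _ (pairModels m)) (trans (length-pairModels m) (sym (+-identityʳ _)))))

justifies-rename : ∀ {b M a x} → Justifies M a x → Justifies (extend b M) (2 + a) (rename (2 +_) x)
justifies-rename (head≡a , act , body) =
  cong (2 +_) head≡a , All.map⁺ act ,
  All.map⁺ (All.map (λ (b∈M , b≢a) → b∈M , b≢a ∘ +-cancelˡ-≡ 2 _ _) body)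

supported-extend : ∀ {m M} b → Supported (pairs m) M → Supported (pairs (suc m)) (extend b M)
supported-extend {m} {M} b (model , supported) = model′ b , supported′ b
  where
  model′ : ∀ b → ReductModel (pairs (suc m)) (extend b M) (extend b M)
  model′ true  (here refl) _ _ = refl
  model′ false (here refl) (() ∷ []) _
  model′ true  (there (here refl)) (() ∷ []) _
  model′ false (there (here refl)) _ _ = refl
  model′ b (there (there x∈)) act body with ∈-map⁻ _ x∈
  ... | x , x∈P , refl = model x∈P (All.map⁻ act) (All.map⁻ body)
  supported′ : ∀ b a → a ∈ₛ extend b M → Any (Justifies (extend b M) a) (pairs (suc m))
  supported′ true  0 _ = here (refl , refl ∷ [] , [])
  supported′ false 1 _ = there (here (refl , refl ∷ [] , []))
  supported′ b (suc (suc a)) a∈M = there (there (Any.map⁺ (Any.map justifies-rename (supported a a∈M))))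

pairModels-stable : ∀ m → All (Stable (pairs m)) (pairModels m)
pairModels-stable m = All.map (supported⇒stable (negative-pairs m)) (pairModels-supported m)
  where
  pairModels-supported : ∀ m → All (Supported (pairs m)) (pairModels m)
  pairModels-supported zero = ((λ ()) , λ _ ()) ∷ []
  pairModels-supported (suc m) = All.++⁺ (All.map⁺ (All.map (supported-extend true) (pairModels-supported m)))
                                         (All.map⁺ (All.map (supported-extend false) (pairModels-supported m)))

pairModels-distinct : ∀ m → AllPairs Differ (pairModels m)
pairModels-distinct zero = [] ∷ []
pairModels-distinct (suc m) = AllPairs.++⁺ (extend-distinct true) (extend-distinct false)
  (All.map⁺ (All.tabulate λ _ → All.map⁺ (All.tabulate λ _ → 0 , λ ())))
  where
  extend-distinct : ∀ b → AllPairs Differ (map (extend b) (pairModels m))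
  extend-distinct b =
    AllPairs.map⁺ (AllPairs.map (λ (a , M≢M′) → suc (suc a) , M≢M′) (pairModels-distinct m))

maxStableCount : ∀ n → IsMaxStableCount n (2 ^ (n / 4))
maxStableCount n =
  (pairs (n / 4) , subst (_≤ n) (sym (size-pairs (n / 4))) (m/n*n≤m n 4) ,
   pairModels (n / 4) , (All.map (from isStable⇔stable) (pairModels-stable (n / 4)) , pairModels-distinct (n / 4)) ,
   length-pairModels (n / 4)) ,
  λ P size≤n Ms (stable , distinct) → ≤-trans
    (countBound P (All.map (to isStable⇔stable) stable) distinct)
    (2^⌊/4⌋-mono (≤-trans (totalWeight≤size P) size≤n))
  where open Equivalence using (to; from)

-- The bound holds for n = 0 as well.
theorem6 : ∃[ a ] ∃[ b ] (∀ n → 1 ≤ n →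
             ∃[ k ] IsMaxStableCount n k × 2 ^ n ≤ a * k ^ 4 × k ^ 4 ≤ b * 2 ^ n)
theorem6 = 8 , 1 , λ n _ → 2 ^ (n / 4) , maxStableCount n , 2^n≤8*[2^⌊n/4⌋]^4 n , [2^⌊n/4⌋]^4≤2^n n
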